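{- Let $p,q$ be relatively prime positive integers, and let $\mathcal{T}_{q/p,p/q}$ be the triangle with vertices $(0,0)$, $(p/q,0)$, $(0,q/p)$. Then $q$ is a quasi-period of the Ehrhart quasipolynomial $I_{\mathcal{T}_{q/p,p/q}}(t)=\#(t\mathcal{T}_{q/p,p/q}\cap\mathbb{Z}^2)$ if and only if $p\mid (q^2+1)$ and $\gcd\!\left(\frac{q^2+1}{p},p\right)=1$.
   Context: For a rational polytope, the Ehrhart function (for positive integers $t$) is a quasipolynomial $\sum_i c_i(t)t^i$ with each $c_i$ periodic in $t$; an integer $N$ is a quasi-period of it if $N$ is a common period of all coefficient functions $c_i$. -}

module Defs where

open import Data.Nat using (ℕ; _+_; _*_; _≤_; _≤?_)
open import Data.Nat.Properties using (_≤?_)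
open import Data.Product using (_×_; _,_; ∃-syntax)
open import Data.List using (List; length; filter; cartesianProduct; upTo)
open import Data.Integer using (+_)
open import Data.Rational as ℚ using (ℚ; _/_)
open import Relation.Binary.PropositionalEquality using (_≡_)

-- Lattice point (x , y) ∈ ℤ² lies in t·T_{q/p,p/q}, where T has vertices
-- (0,0), (p/q,0), (0,q/p), iff x ≥ 0, y ≥ 0 and x·(q/p) + y·(p/q) ≤ t,
-- i.e. (clearing the positive denominator pq) q²x + p²y ≤ pqt.
-- Nonnegative coordinates are enforced by ranging over ℕ².
InDilate : ℕ → ℕ → ℕ → ℕ × ℕ → Set
InDilate p q t (x , y) = q * q * x + p * p * y ≤ p * q * t

inDilate? : ∀ p q t (v : ℕ × ℕ) → _
inDilate? p q t (x , y) = q * q * x + p * p * y ≤? p * q * t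

-- Ehrhart function I(t) = #(t T ∩ ℤ²).  For p, q ≥ 1 every lattice point of
-- t T has coordinates ≤ pqt, so enumerating the box [0, pqt]² is exhaustive.
ehrhart : ℕ → ℕ → ℕ → ℕ
ehrhart p q t =
  length (filter (inDilate? p q t)
    (cartesianProduct (upTo (1 + p * q * t)) (upTo (1 + p * q * t))))

toℚ : ℕ → ℚ
toℚ n = (+ n) / 1

Periodic : ℕ → (ℕ → ℚ) → Set
Periodic N c = ∀ t → c (t + N) ≡ c t

IsQuasiPeriod : (ℕ → ℕ) → ℕ → Set
IsQuasiPeriod f N =
  ∃[ c₀ ] ∃[ c₁ ] ∃[ c₂ ]
    (Periodic N c₀ × Periodic N c₁ × Periodic N c₂ ×
     (∀ t → 1 ≤ t →
        toℚ (f t) ≡ c₂ t ℚ.* (toℚ t ℚ.* toℚ t) ℚ.+ c₁ t ℚ.* toℚ t ℚ.+ c₀ t))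

module Submission where

-- Counting lattice points column by column gives I(t + q) = I(t) + D(t), where
-- D(t) = p + Σ_{k=1..p} ⌊(qt + ⌊Qk/p⌋)/p⌋ and Q = q². As I is quadratic, q is a quasi-period
-- iff D(t + q) - D(t) is independent of t. This increment is a sum of carries
-- Σ_k ⌊((qt + ⌊Qk/p⌋) mod p + Q)/p⌋ depending only on qt mod p; since q and Q are units mod p
-- and carries of Q telescope into carries of 1, its constancy is equivalent to constancy of
-- h(w) = #{k ≤ p : p ∣ w + 1 + ⌊Qk/p⌋}. If Q + 1 = cp then ⌊Qk/p⌋ = ck - 1, and h is constant
-- iff gcd(c, p) = 1. Conversely, the symmetry ⌊Qk/p⌋ + ⌊Q(p-k)/p⌋ = Q - 1 shows that
-- h(0) = h(-(Q + 1)) forces p ∣ Q + 1.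

open import Defs
open import Data.Nat using (ℕ; _+_; _*_; _/_; NonZero)
open import Data.Nat.Divisibility using (_∣_)
open import Data.Nat.GCD using (gcd)
open import Data.Nat.Coprimality using (Coprime)
open import Data.Product using (_×_)
open import Function.Bundles using (_⇔_; mk⇔; Equivalence)
open import Relation.Binary.PropositionalEquality using (_≡_)

open import Data.Nat
open import Data.Nat.Properties
open import Data.Nat.DivMod
open import Data.Nat.Divisibility
  using ( divides; _∣?_; ∣-refl; ∣-trans; ∣⇒≤; ∣1⇒≡1; m∣m*n; n∣m*n; ∣m⇒∣m*n; ∣m+n∣m⇒∣n; ∣m∣n⇒∣m+n
        ; m%n≡0⇒n∣m; n∣m⇒m%n≡0)
open import Data.Nat.GCD using (module Bézout)
open import Data.Nat.Coprimality using (coprime-Bézout; coprime-divisor; 1-coprimeTo; coprime⇒gcd≡1; gcd≡1⇒coprime)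
import Data.Nat.Coprimality as Coprime
open import Data.Nat.Tactic.RingSolver using (solve-∀)
import Data.Integer as ℤ
import Data.Integer.Properties as ℤP
open import Data.Integer.Tactic.RingSolver using () renaming (solve-∀ to solve-∀ℤ)
open import Data.Rational as ℚ using (ℚ; mkℚ; 0ℚ; 1ℚ; ½)
import Data.Rational.Properties as ℚP
import Data.Rational.Unnormalised as ℚᵘ
import Data.Rational.Unnormalised.Properties as ℚᵘP
import Tactic.RingSolver as Ring
import Tactic.RingSolver.Core.AlmostCommutativeRing as ACR
open import Data.List using (length; filter; cartesianProduct; upTo; applyUpTo; map; _++_)
open import Data.List.Properties using (length-++; filter-++; map-applyUpTo)
open import Data.Product using (_,_; proj₁; proj₂; ∃-syntax)
open import Algebra.Properties.CommutativeSemigroup +-commutativeSemigroup using (interchange)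
open import Function.Base using (_∘_)
open import Level using (0ℓ)
open import Relation.Nullary using (Dec; yes; no; ¬_; contradiction)
open import Relation.Nullary.Decidable using (dec⇒maybe)
open import Relation.Binary.PropositionalEquality
  using (refl; sym; trans; cong; cong₂; subst; subst₂; _≢_; module ≡-Reasoning)

private variable A B : Set

𝟙 : Dec A → ℕ
𝟙 (yes _) = 1
𝟙 (no _) = 0

𝟙-yes : (a? : Dec A) → A → 𝟙 a? ≡ 1
𝟙-yes (yes _) _ = refl
𝟙-yes (no ¬a) a = contradiction a ¬a

𝟙-no : (a? : Dec A) → ¬ A → 𝟙 a? ≡ 0
𝟙-no (yes a) ¬a = contradiction a ¬a
𝟙-no (no _) _ = refl

𝟙-positive : (a? : Dec A) → 0 < 𝟙 a? → A
𝟙-positive (yes a) _ = a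

𝟙-cong : (a? : Dec A) (b? : Dec B) → (A → B) → (B → A) → 𝟙 a? ≡ 𝟙 b?
𝟙-cong (yes a) b? f g = sym (𝟙-yes b? (f a))
𝟙-cong (no ¬a) b? f g = sym (𝟙-no b? (¬a ∘ g))

∑< : ℕ → (ℕ → ℕ) → ℕ
∑< zero h = 0
∑< (suc n) h = h 0 + ∑< n (h ∘ suc)

syntax ∑< n (λ i → e) = ∑[ i < n ] e

∑-cong : ∀ n {g h : ℕ → ℕ} → (∀ i → i < n → g i ≡ h i) → ∑< n g ≡ ∑< n h
∑-cong zero eq = refl
∑-cong (suc n) eq = cong₂ _+_ (eq 0 z<s) (∑-cong n (λ i i<n → eq (suc i) (s<s i<n)))

∑-+ : ∀ n (g h : ℕ → ℕ) → ∑[ i < n ] (g i + h i) ≡ ∑< n g + ∑< n h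
∑-+ zero g h = refl
∑-+ (suc n) g h =
  trans (cong ((g 0 + h 0) +_) (∑-+ n (g ∘ suc) (h ∘ suc))) (interchange (g 0) (h 0) _ _)

∑-const : ∀ n c → ∑[ _ < n ] c ≡ n * c
∑-const zero c = refl
∑-const (suc n) c = cong (c +_) (∑-const n c)

∑-split : ∀ m n h → ∑< (m + n) h ≡ ∑< m h + ∑[ i < n ] h (m + i)
∑-split zero n h = refl
∑-split (suc m) n h = trans (cong (h 0 +_) (∑-split m n (h ∘ suc))) (sym (+-assoc (h 0) _ _))

∑-last : ∀ n h → ∑< (suc n) h ≡ ∑< n h + h n
∑-last zero h = +-identityʳ (h 0)
∑-last (suc n) h = trans (cong (h 0 +_) (∑-last n (h ∘ suc))) (sym (+-assoc (h 0) _ _))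

∑-reverse : ∀ n h → ∑< n h ≡ ∑[ i < n ] h (n ∸ suc i)
∑-reverse zero h = refl
∑-reverse (suc n) h = begin
  h 0 + ∑< n (h ∘ suc)                           ≡⟨ cong (h 0 +_) (∑-reverse n (h ∘ suc)) ⟩
  h 0 + ∑[ i < n ] h (suc (n ∸ suc i))           ≡⟨ +-comm (h 0) _ ⟩
  ∑[ i < n ] h (suc (n ∸ suc i)) + h 0           ≡⟨ cong₂ _+_ (∑-cong n λ i i<n → cong h (sym (+-∸-assoc 1 i<n)))
                                                              (cong h (sym (n∸n≡0 n))) ⟩
  ∑[ i < n ] h (suc n ∸ suc i) + h (suc n ∸ suc n) ≡⟨ ∑-last n (λ i → h (suc n ∸ suc i)) ⟨
  ∑[ i < suc n ] h (suc n ∸ suc i)               ∎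
  where open ≡-Reasoning

∑-rotate : ∀ n h → h n ≡ h 0 → ∑[ i < n ] h (suc i) ≡ ∑< n h
∑-rotate zero h _ = refl
∑-rotate (suc n) h hn≡h0 = begin
  ∑[ i < suc n ] h (suc i)             ≡⟨ ∑-last n (h ∘ suc) ⟩
  ∑[ i < n ] h (suc i) + h (suc n)     ≡⟨ cong (∑< n (h ∘ suc) +_) hn≡h0 ⟩
  ∑[ i < n ] h (suc i) + h 0           ≡⟨ +-comm _ (h 0) ⟩
  ∑< (suc n) h                         ∎
  where open ≡-Reasoning

∑-zero : ∀ n {h} → (∀ i → i < n → h i ≡ 0) → ∑< n h ≡ 0
∑-zero n vanish = trans (∑-cong n vanish) (trans (∑-const n 0) (*-zeroʳ n))

∑-truncate : ∀ {m n} h → n ≤ m → (∀ i → n ≤ i → h i ≡ 0) → ∑< m h ≡ ∑< n h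
∑-truncate {m} {n} h n≤m vanish = begin
  ∑< m h                                ≡⟨ cong (λ k → ∑< k h) (m+[n∸m]≡n n≤m) ⟨
  ∑< (n + (m ∸ n)) h                    ≡⟨ ∑-split n (m ∸ n) h ⟩
  ∑< n h + ∑[ i < m ∸ n ] h (n + i)     ≡⟨ cong (∑< n h +_) (∑-zero (m ∸ n) λ i _ → vanish (n + i) (m≤m+n n i)) ⟩
  ∑< n h + 0                            ≡⟨ +-identityʳ _ ⟩
  ∑< n h                                ∎
  where open ≡-Reasoning

term≤∑ : ∀ n h {i} → i < n → h i ≤ ∑< n h
term≤∑ (suc n) h {zero} _ = m≤m+n (h 0) _
term≤∑ (suc n) h {suc i} (s<s i<n) = ≤-trans (term≤∑ n (h ∘ suc) i<n) (m≤n+m _ (h 0))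

∑-positive : ∀ n h → 0 < ∑< n h → ∃[ i ] i < n × 0 < h i
∑-positive (suc n) h pos with h 0 in eq
... | suc _ = 0 , z<s , subst (0 <_) (sym eq) z<s
... | zero with ∑-positive n (h ∘ suc) pos
...   | i , i<n , hi>0 = suc i , s<s i<n , hi>0

∑-𝟙-≤ : ∀ {N K} → K < N → ∑[ y < N ] 𝟙 (y ≤? K) ≡ suc K
∑-𝟙-≤ {suc N} {zero} _ = cong suc (∑-zero N λ i _ → 𝟙-no (suc i ≤? 0) λ ())
∑-𝟙-≤ {suc N} {suc K} (s<s K<N) =
  cong suc (trans (∑-cong N (λ i _ → 𝟙-cong (suc i ≤? suc K) (i ≤? K) s≤s⁻¹ s≤s)) (∑-𝟙-≤ K<N))

length-filter-applyUpTo : {P : A → Set} (P? : ∀ x → Dec (P x)) (f : ℕ → A) (n : ℕ) →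
  length (filter P? (applyUpTo f n)) ≡ ∑[ i < n ] 𝟙 (P? (f i))
length-filter-applyUpTo P? f zero = refl
length-filter-applyUpTo P? f (suc n) with P? (f 0)
... | yes _ = cong suc (length-filter-applyUpTo P? (f ∘ suc) n)
... | no _ = length-filter-applyUpTo P? (f ∘ suc) n

length-filter-cartesianProduct : {P : ℕ × ℕ → Set} (P? : ∀ x → Dec (P x)) (f : ℕ → ℕ) (m n : ℕ) →
  length (filter P? (cartesianProduct (applyUpTo f m) (upTo n))) ≡ ∑[ x < m ] ∑[ y < n ] 𝟙 (P? (f x , y))
length-filter-cartesianProduct P? f zero n = refl
length-filter-cartesianProduct P? f (suc m) n = begin
  length (filter P? (row ++ rest))                     ≡⟨ cong length (filter-++ P? row rest) ⟩
  length (filter P? row ++ filter P? rest)             ≡⟨ length-++ (filter P? row) ⟩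
  length (filter P? row) + length (filter P? rest)     ≡⟨ cong₂ _+_ count-row (length-filter-cartesianProduct P? (f ∘ suc) m n) ⟩
  ∑[ y < n ] 𝟙 (P? (f 0 , y)) + ∑[ x < m ] ∑[ y < n ] 𝟙 (P? (f (suc x) , y)) ∎
  where
  open ≡-Reasoning
  row = map (f 0 ,_) (upTo n)
  rest = cartesianProduct (applyUpTo (f ∘ suc) m) (upTo n)
  count-row : length (filter P? row) ≡ ∑[ y < n ] 𝟙 (P? (f 0 , y))
  count-row = trans (cong (length ∘ filter P?) (map-applyUpTo (λ y → y) (f 0 ,_) n))
                    (length-filter-applyUpTo P? (f 0 ,_) n)

[m*n+o]/m≡n+o/m : ∀ m n o .{{_ : NonZero m}} → (m * n + o) / m ≡ n + o / m
[m*n+o]/m≡n+o/m m n o =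
  trans (+-distrib-/-∣ˡ o (m∣m*n n)) (cong (_+ o / m) (trans (cong (_/ m) (*-comm m n)) (m*n/n≡m n m)))

[m+n]/d≡m/d+[m%d+n]/d : ∀ m n d .{{_ : NonZero d}} → (m + n) / d ≡ m / d + (m % d + n) / d
[m+n]/d≡m/d+[m%d+n]/d m n d = begin
  (m + n) / d                       ≡⟨ cong (λ x → (x + n) / d) (m≡m%n+[m/n]*n m d) ⟩
  (m % d + m / d * d + n) / d       ≡⟨ cong (_/ d) (regroup (m % d) (m / d) n d) ⟩
  (d * (m / d) + (m % d + n)) / d   ≡⟨ [m*n+o]/m≡n+o/m d (m / d) (m % d + n) ⟩
  m / d + (m % d + n) / d           ∎
  where
  open ≡-Reasoning
  regroup : ∀ r k n d → r + k * d + n ≡ d * k + (r + n)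
  regroup = solve-∀

1+m≡[m/d]*d+[m%d+1] : ∀ m d .{{_ : NonZero d}} → suc m ≡ m / d * d + (m % d + 1)
1+m≡[m/d]*d+[m%d+1] m d = trans (cong suc (m≡m%n+[m/n]*n m d)) (reorder (m % d) (m / d * d))
  where
  reorder : ∀ r k → suc (r + k) ≡ k + (r + 1)
  reorder = solve-∀

[m%d+1]/d≡𝟙[d∣1+m] : ∀ m d .{{_ : NonZero d}} → (m % d + 1) / d ≡ 𝟙 (d ∣? suc m)
[m%d+1]/d≡𝟙[d∣1+m] m d with d ∣? suc m
... | yes d∣1+m = trans (cong (_/ d) (sym d≡r+1)) (n/n≡1 d)
  where
  d≡r+1 : d ≡ m % d + 1
  d≡r+1 = ≤-antisym (subst (d ≤_) (+-comm 1 (m % d)) (∣⇒≤ (subst (d ∣_) (+-comm (m % d) 1) d∣r+1)))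
                    (subst (_≤ d) (+-comm 1 (m % d)) (m%n<n m d))
    where
    d∣r+1 : d ∣ m % d + 1
    d∣r+1 = ∣m+n∣m⇒∣n (subst (d ∣_) (1+m≡[m/d]*d+[m%d+1] m d) d∣1+m) (n∣m*n (m / d))
... | no d∤1+m = m<n⇒m/n≡0 (≤∧≢⇒< (subst (_≤ d) (+-comm 1 (m % d)) (m%n<n m d)) r+1≢d)
  where
  r+1≢d : m % d + 1 ≢ d
  r+1≢d eq = d∤1+m (divides (suc (m / d))
    (trans (1+m≡[m/d]*d+[m%d+1] m d) (trans (cong (m / d * d +_) eq) (+-comm _ d))))

coprime-*ʳ : ∀ {m n o} → Coprime m n → Coprime m o → Coprime m (n * o)
coprime-*ʳ {m} {n} {o} m⊥n m⊥o (d∣m , d∣no) = m⊥o (d∣m , coprime-divisor d⊥n d∣no)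
  where
  d⊥n : Coprime _ n
  d⊥n (e∣d , e∣n) = m⊥n (∣-trans e∣d d∣m , e∣n)

coprime⇒invertible : ∀ {c p} .{{_ : NonZero p}} → Coprime c p → ∃[ x ] (c * x) % p ≡ 1 % p
coprime⇒invertible {c} {p@(suc a)} c⊥p with coprime-Bézout c⊥p
... | Bézout.+- x y 1+yp≡xc = x , (begin
  (c * x) % p          ≡⟨ cong (_% p) (trans (*-comm c x) (sym 1+yp≡xc)) ⟩
  (1 + y * p) % p      ≡⟨ [m+kn]%n≡m%n 1 y p ⟩
  1 % p                ∎)
  where open ≡-Reasoning
-- From 1 + x c = y p, c x ≡ -1, so c (x (p - 1)) ≡ 1.
... | Bézout.-+ x y 1+xc≡yp = x * a , (begin
  (c * (x * a)) % p            ≡⟨ [m+n]%n≡m%n (c * (x * a)) p ⟨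
  (c * (x * a) + p) % p        ≡⟨ cong (_% p) (regroup c x a) ⟩
  (1 + (1 + x * c) * a) % p    ≡⟨ cong (λ z → (1 + z * a) % p) 1+xc≡yp ⟩
  (1 + y * p * a) % p          ≡⟨ cong (λ z → (1 + z) % p) (swap y p a) ⟩
  (1 + y * a * p) % p          ≡⟨ [m+kn]%n≡m%n 1 (y * a) p ⟩
  1 % p                        ∎)
  where
  open ≡-Reasoning
  regroup : ∀ c x a → c * (x * a) + suc a ≡ 1 + (1 + x * c) * a
  regroup = solve-∀
  swap : ∀ y p a → y * p * a ≡ y * a * p
  swap = solve-∀

module _ {p} .{{_ : NonZero p}} where

  %-+-congˡ : ∀ {u v} w → u % p ≡ v % p → (u + w) % p ≡ (v + w) % p
  %-+-congˡ {u} {v} w eq = begin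
    (u + w) % p               ≡⟨ %-distribˡ-+ u w p ⟩
    (u % p + w % p) % p       ≡⟨ cong (λ z → (z + w % p) % p) eq ⟩
    (v % p + w % p) % p       ≡⟨ %-distribˡ-+ v w p ⟨
    (v + w) % p               ∎
    where open ≡-Reasoning

  inverse-cancel : ∀ {c x} w → (c * x) % p ≡ 1 % p → (c * x * w) % p ≡ w % p
  inverse-cancel {c} {x} w c*x≡1 = begin
    (c * x * w) % p                    ≡⟨ %-distribˡ-* (c * x) w p ⟩
    ((c * x) % p * (w % p)) % p        ≡⟨ cong (λ r → (r * (w % p)) % p) c*x≡1 ⟩
    ((1 % p) * (w % p)) % p            ≡⟨ %-distribˡ-* 1 w p ⟨
    (1 * w) % p                        ≡⟨ cong (_% p) (*-identityˡ w) ⟩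
    w % p                              ∎
    where open ≡-Reasoning

  translation-invariant⇒constant : ∀ {h : ℕ → ℕ} {c x} → (∀ {u v} → u % p ≡ v % p → h u ≡ h v) →
    (c * x) % p ≡ 1 % p → (∀ w → h (w + c) ≡ h w) → ∀ w → h w ≡ h 0
  translation-invariant⇒constant {h} {c} {x} h-mod cx≡1 h-step = constant
    where
    h-steps : ∀ w n → h (w + c * n) ≡ h w
    h-steps w zero = cong h (trans (cong (w +_) (*-zeroʳ c)) (+-identityʳ w))
    h-steps w (suc n) = trans (cong h (reassoc w c n)) (trans (h-step (w + c * n)) (h-steps w n))
      where
      reassoc : ∀ w c n → w + c * suc n ≡ w + c * n + c
      reassoc = solve-∀

    h-suc : ∀ w → h (suc w) ≡ h w
    h-suc w = trans (h-mod (trans (%-+-congˡ w (sym cx≡1)) (cong (_% p) (+-comm (c * x) w)))) (h-steps w x)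

    constant : ∀ w → h w ≡ h 0
    constant zero = refl
    constant (suc w) = trans (h-suc w) (constant w)

-- The zero test lets the solver drop cancelled monomials.
ℚ-ring : ACR.AlmostCommutativeRing 0ℓ 0ℓ
ℚ-ring = ACR.fromCommutativeRing ℚP.+-*-commutativeRing (λ x → dec⇒maybe (0ℚ ℚP.≟ x))

module _ where
  open ℤ using (+_)

  coprimeTo-1 : ∀ n → Coprime n 1
  coprimeTo-1 n = Coprime.sym (1-coprimeTo n)

  toℚ≡mkℚ : ∀ n → toℚ n ≡ mkℚ (+ n) 0 (coprimeTo-1 n)
  toℚ≡mkℚ n = ℚP.normalize-coprime (coprimeTo-1 n)

  toℚ-+ : ∀ m n → toℚ (m + n) ≡ toℚ m ℚ.+ toℚ n
  toℚ-+ m n rewrite toℚ≡mkℚ (m + n) | toℚ≡mkℚ m | toℚ≡mkℚ n =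
    ℚP.toℚᵘ-injective (ℚᵘP.≃-trans (ℚᵘ.*≡* numerators)
      (ℚᵘP.≃-sym (ℚP.toℚᵘ-homo-+ (mkℚ (+ m) 0 (coprimeTo-1 m)) (mkℚ (+ n) 0 (coprimeTo-1 n)))))
    where
    numerators : + (m + n) ℤ.* + 1 ≡ (+ m ℤ.* + 1 ℤ.+ + n ℤ.* + 1) ℤ.* + 1
    numerators = trans (cong (ℤ._* + 1) (ℤP.pos-+ m n)) (lemma (+ m) (+ n))
      where
      lemma : ∀ a b → (a ℤ.+ b) ℤ.* + 1 ≡ (a ℤ.* + 1 ℤ.+ b ℤ.* + 1) ℤ.* + 1
      lemma = solve-∀ℤ

  toℚ-injective : ∀ {m n} → toℚ m ≡ toℚ n → m ≡ n
  toℚ-injective {m} {n} eq rewrite toℚ≡mkℚ m | toℚ≡mkℚ n = cong (λ r → ℤ.∣ ℚ.numerator r ∣) eq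

toℚ-+₃ : ∀ a b c → toℚ (a + b + c) ≡ toℚ a ℚ.+ toℚ b ℚ.+ toℚ c
toℚ-+₃ a b c = trans (toℚ-+ (a + b) c) (cong (ℚ._+ toℚ c) (toℚ-+ a b))

quasiPeriod⇒third-difference : ∀ {f N} → IsQuasiPeriod f N → ∀ t → 1 ≤ t →
  f (t + N + N + N) + (f (t + N) + f (t + N) + f (t + N)) ≡ (f (t + N + N) + f (t + N + N) + f (t + N + N)) + f t
quasiPeriod⇒third-difference {f} {N} (c₀ , c₁ , c₂ , c₀-per , c₁-per , c₂-per , f≡) t 1≤t = toℚ-injective (begin
  toℚ (f (s 3) + (f (s 1) + f (s 1) + f (s 1)))
    ≡⟨ trans (toℚ-+ (f (s 3)) _) (cong (toℚ (f (s 3)) ℚ.+_) (toℚ-+₃ (f (s 1)) _ _)) ⟩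
  toℚ (f (s 3)) ℚ.+ (toℚ (f (s 1)) ℚ.+ toℚ (f (s 1)) ℚ.+ toℚ (f (s 1)))
    ≡⟨ cong₂ (λ a b → a ℚ.+ (b ℚ.+ b ℚ.+ b)) (on-orbit 3) (on-orbit 1) ⟩
  Y (T ℚ.+ Nq ℚ.+ Nq ℚ.+ Nq) ℚ.+ (Y (T ℚ.+ Nq) ℚ.+ Y (T ℚ.+ Nq) ℚ.+ Y (T ℚ.+ Nq))
    ≡⟨ third-difference-of-quadratic (c₂ t) (c₁ t) (c₀ t) T Nq ⟩
  (Y (T ℚ.+ Nq ℚ.+ Nq) ℚ.+ Y (T ℚ.+ Nq ℚ.+ Nq) ℚ.+ Y (T ℚ.+ Nq ℚ.+ Nq)) ℚ.+ Y T
    ≡⟨ cong₂ (λ a b → (a ℚ.+ a ℚ.+ a) ℚ.+ b) (on-orbit 2) (on-orbit 0) ⟨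
  (toℚ (f (s 2)) ℚ.+ toℚ (f (s 2)) ℚ.+ toℚ (f (s 2))) ℚ.+ toℚ (f t)
    ≡⟨ trans (toℚ-+ (f (s 2) + f (s 2) + f (s 2)) (f t)) (cong (ℚ._+ toℚ (f t)) (toℚ-+₃ (f (s 2)) _ _)) ⟨
  toℚ ((f (s 2) + f (s 2) + f (s 2)) + f t) ∎)
  where
  open ≡-Reasoning
  T = toℚ t
  Nq = toℚ N
  Y : ℚ → ℚ
  Y S = c₂ t ℚ.* (S ℚ.* S) ℚ.+ c₁ t ℚ.* S ℚ.+ c₀ t

  third-difference-of-quadratic : ∀ a b c T N → let Y = λ S → a ℚ.* (S ℚ.* S) ℚ.+ b ℚ.* S ℚ.+ c in
    Y (T ℚ.+ N ℚ.+ N ℚ.+ N) ℚ.+ (Y (T ℚ.+ N) ℚ.+ Y (T ℚ.+ N) ℚ.+ Y (T ℚ.+ N))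
      ≡ (Y (T ℚ.+ N ℚ.+ N) ℚ.+ Y (T ℚ.+ N ℚ.+ N) ℚ.+ Y (T ℚ.+ N ℚ.+ N)) ℚ.+ Y T
  third-difference-of-quadratic = Ring.solve-∀ ℚ-ring

  s : ℕ → ℕ
  s zero = t
  s (suc k) = s k + N

  sq : ℕ → ℚ
  sq zero = T
  sq (suc k) = sq k ℚ.+ Nq

  toℚ-s : ∀ k → toℚ (s k) ≡ sq k
  toℚ-s zero = refl
  toℚ-s (suc k) = trans (toℚ-+ (s k) N) (cong (ℚ._+ Nq) (toℚ-s k))

  1≤s : ∀ k → 1 ≤ s k
  1≤s zero = 1≤t
  1≤s (suc k) = ≤-trans (1≤s k) (m≤m+n (s k) N)

  periodic-on-orbit : ∀ {c} → Periodic N c → ∀ k → c (s k) ≡ c t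
  periodic-on-orbit c-per zero = refl
  periodic-on-orbit c-per (suc k) = trans (c-per (s k)) (periodic-on-orbit c-per k)

  quadratic-cong : ∀ {a a' b b' c c' x x'} → a ≡ a' → b ≡ b' → c ≡ c' → x ≡ x' →
    a ℚ.* (x ℚ.* x) ℚ.+ b ℚ.* x ℚ.+ c ≡ a' ℚ.* (x' ℚ.* x') ℚ.+ b' ℚ.* x' ℚ.+ c'
  quadratic-cong refl refl refl refl = refl

  on-orbit : ∀ k → toℚ (f (s k)) ≡ Y (sq k)
  on-orbit k = trans (f≡ (s k) (1≤s k))
    (quadratic-cong (periodic-on-orbit c₂-per k) (periodic-on-orbit c₁-per k) (periodic-on-orbit c₀-per k) (toℚ-s k))

constant-second-difference⇒quasiPeriod : ∀ {f D : ℕ → ℕ} {K N} .{{_ : NonZero N}} →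
  (∀ t → f (t + N) ≡ f t + D t) → (∀ t → D (t + N) ≡ D t + K) → IsQuasiPeriod f N
constant-second-difference⇒quasiPeriod {f} {D} {K} {N} f-step D-step =
  c₀ , c₁ , c₂ , c₀-per , c₁-per , (λ _ → refl) , f≡
  where
  open ≡-Reasoning
  Nq = toℚ N
  Kq = toℚ K
  u : ℚ
  u = ℚ.1/ mkℚ (ℤ.+ N) 0 (coprimeTo-1 N)
  u*N≡1 : u ℚ.* Nq ≡ 1ℚ
  u*N≡1 = trans (cong (u ℚ.*_) (toℚ≡mkℚ N)) (ℚP.*-inverseˡ (mkℚ (ℤ.+ N) 0 (coprimeTo-1 N)))

  -- For t = r + n N one has f t = f r + n D r + n (n - 1) K / 2; expanded in t this gives:
  c₂ c₁ c₀ : ℕ → ℚ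
  c₂ _ = Kq ℚ.* u ℚ.* u ℚ.* ½
  c₁ t = (toℚ (D t) ℚ.- Kq ℚ.* toℚ t ℚ.* u) ℚ.* u ℚ.- Kq ℚ.* u ℚ.* ½
  c₀ t = toℚ (f t) ℚ.- c₂ t ℚ.* (toℚ t ℚ.* toℚ t) ℚ.- c₁ t ℚ.* toℚ t

  f≡ : ∀ t → 1 ≤ t → toℚ (f t) ≡ c₂ t ℚ.* (toℚ t ℚ.* toℚ t) ℚ.+ c₁ t ℚ.* toℚ t ℚ.+ c₀ t
  f≡ t _ = split (toℚ (f t)) (c₂ t ℚ.* (toℚ t ℚ.* toℚ t)) (c₁ t ℚ.* toℚ t)
    where
    split : ∀ F a b → F ≡ a ℚ.+ b ℚ.+ (F ℚ.- a ℚ.- b)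
    split = Ring.solve-∀ ℚ-ring

  -- The solver cannot use u * N = 1 or ½ + ½ = 1, so the identities below isolate them.
  cancel : ∀ {a} x y → a ≡ 1ℚ → x ℚ.+ (1ℚ ℚ.- a) ℚ.* y ≡ x
  cancel x y refl = trans (cong (λ z → x ℚ.+ z ℚ.* y) (ℚP.+-inverseʳ 1ℚ))
                          (trans (cong (x ℚ.+_) (ℚP.*-zeroˡ y)) (ℚP.+-identityʳ x))

  c₁-per : Periodic N c₁
  c₁-per t = begin
    c₁ (t + N)
      ≡⟨ cong₂ (λ d s → (d ℚ.- Kq ℚ.* s ℚ.* u) ℚ.* u ℚ.- Kq ℚ.* u ℚ.* ½)
               (trans (cong toℚ (D-step t)) (toℚ-+ (D t) K)) (toℚ-+ t N) ⟩
    (toℚ (D t) ℚ.+ Kq ℚ.- Kq ℚ.* (toℚ t ℚ.+ Nq) ℚ.* u) ℚ.* u ℚ.- Kq ℚ.* u ℚ.* ½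
      ≡⟨ identity (toℚ (D t)) Kq (toℚ t) Nq u ½ ⟩
    c₁ t ℚ.+ (1ℚ ℚ.- u ℚ.* Nq) ℚ.* (Kq ℚ.* u)
      ≡⟨ cancel (c₁ t) (Kq ℚ.* u) u*N≡1 ⟩
    c₁ t ∎
    where
    identity : ∀ D K T N u h → (D ℚ.+ K ℚ.- K ℚ.* (T ℚ.+ N) ℚ.* u) ℚ.* u ℚ.- K ℚ.* u ℚ.* h
      ≡ ((D ℚ.- K ℚ.* T ℚ.* u) ℚ.* u ℚ.- K ℚ.* u ℚ.* h) ℚ.+ (1ℚ ℚ.- u ℚ.* N) ℚ.* (K ℚ.* u)
    identity = Ring.solve-∀ ℚ-ring

  c₀-per : Periodic N c₀
  c₀-per t = begin
    c₀ (t + N)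
      ≡⟨ cong₂ (λ F s → F ℚ.- c₂ t ℚ.* (s ℚ.* s) ℚ.- c₁ (t + N) ℚ.* s)
               (trans (cong toℚ (f-step t)) (toℚ-+ (f t) (D t))) (toℚ-+ t N) ⟩
    (F ℚ.+ Dq) ℚ.- c₂ t ℚ.* ((T ℚ.+ Nq) ℚ.* (T ℚ.+ Nq)) ℚ.- c₁ (t + N) ℚ.* (T ℚ.+ Nq)
      ≡⟨ cong (λ c → (F ℚ.+ Dq) ℚ.- c₂ t ℚ.* ((T ℚ.+ Nq) ℚ.* (T ℚ.+ Nq)) ℚ.- c ℚ.* (T ℚ.+ Nq)) (c₁-per t) ⟩
    (F ℚ.+ Dq) ℚ.- c₂ t ℚ.* ((T ℚ.+ Nq) ℚ.* (T ℚ.+ Nq)) ℚ.- c₁ t ℚ.* (T ℚ.+ Nq)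
      ≡⟨ identity F Dq Kq T Nq u ½ ⟩
    (c₀ t ℚ.+ (1ℚ ℚ.- u ℚ.* Nq) ℚ.* (Dq ℚ.+ Kq ℚ.* ½ ℚ.* u ℚ.* Nq))
      ℚ.+ (1ℚ ℚ.- (½ ℚ.+ ½)) ℚ.* (Kq ℚ.* T ℚ.* u ℚ.* u ℚ.* Nq)
      ≡⟨ cancel _ (Kq ℚ.* T ℚ.* u ℚ.* u ℚ.* Nq) refl ⟩
    c₀ t ℚ.+ (1ℚ ℚ.- u ℚ.* Nq) ℚ.* (Dq ℚ.+ Kq ℚ.* ½ ℚ.* u ℚ.* Nq)
      ≡⟨ cancel (c₀ t) _ u*N≡1 ⟩
    c₀ t ∎
    where
    F = toℚ (f t)
    Dq = toℚ (D t)
    T = toℚ t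
    identity : ∀ F D K T N u h →
      let c₂ = K ℚ.* u ℚ.* u ℚ.* h
          c₁ = (D ℚ.- K ℚ.* T ℚ.* u) ℚ.* u ℚ.- K ℚ.* u ℚ.* h in
      (F ℚ.+ D) ℚ.- c₂ ℚ.* ((T ℚ.+ N) ℚ.* (T ℚ.+ N)) ℚ.- c₁ ℚ.* (T ℚ.+ N)
        ≡ ((F ℚ.- c₂ ℚ.* (T ℚ.* T) ℚ.- c₁ ℚ.* T) ℚ.+ (1ℚ ℚ.- u ℚ.* N) ℚ.* (D ℚ.+ K ℚ.* h ℚ.* u ℚ.* N))
          ℚ.+ (1ℚ ℚ.- (h ℚ.+ h)) ℚ.* (K ℚ.* T ℚ.* u ℚ.* u ℚ.* N)
    identity = Ring.solve-∀ ℚ-ring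

third-difference⇒periodic-increment : ∀ {f D K : ℕ → ℕ} {N} →
  (∀ s → f (s + N) ≡ f s + D s) → (∀ s → D (s + N) ≡ D s + K s) → ∀ t →
  f (t + N + N + N) + (f (t + N) + f (t + N) + f (t + N)) ≡ (f (t + N + N) + f (t + N + N) + f (t + N + N)) + f t →
  K (t + N) ≡ K t
third-difference⇒periodic-increment {f} {D} {K} {N} f-step D-step t third =
  increments (f t) (D t) (K t) (K (t + N)) (f-step t) (D-step t) (f-step (t + N)) (D-step (t + N)) (f-step (t + N + N)) third
  where
  increments : ∀ f₀ D₀ K₀ K₁ {f₁ D₁ f₂ D₂ f₃} →
    f₁ ≡ f₀ + D₀ → D₁ ≡ D₀ + K₀ → f₂ ≡ f₁ + D₁ → D₂ ≡ D₁ + K₁ → f₃ ≡ f₂ + D₂ →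
    f₃ + (f₁ + f₁ + f₁) ≡ (f₂ + f₂ + f₂) + f₀ → K₁ ≡ K₀
  increments f₀ D₀ K₀ K₁ refl refl refl refl refl eq =
    +-cancelˡ-≡ (4 * f₀ + 6 * D₀ + 2 * K₀) K₁ K₀ (trans (lhs f₀ D₀ K₀ K₁) (trans eq (rhs f₀ D₀ K₀)))
    where
    lhs : ∀ f₀ D₀ K₀ K₁ → 4 * f₀ + 6 * D₀ + 2 * K₀ + K₁
        ≡ ((f₀ + D₀) + (D₀ + K₀)) + ((D₀ + K₀) + K₁) + ((f₀ + D₀) + (f₀ + D₀) + (f₀ + D₀))
    lhs = solve-∀
    rhs : ∀ f₀ D₀ K₀ → (((f₀ + D₀) + (D₀ + K₀)) + ((f₀ + D₀) + (D₀ + K₀)) + ((f₀ + D₀) + (D₀ + K₀))) + f₀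
        ≡ 4 * f₀ + 6 * D₀ + 2 * K₀ + K₀
    rhs = solve-∀

module Carries (p : ℕ) .{{_ : NonZero p}} (b : ℕ → ℕ) where

  floorSum : ℕ → ℕ
  floorSum w = ∑[ i < p ] ((w + b i) / p)

  carry : ℕ → ℕ → ℕ
  carry m w = ∑[ i < p ] (((w + b i) % p + m) / p)

  floorSum-+ : ∀ w m → floorSum (w + m) ≡ floorSum w + carry m w
  floorSum-+ w m = trans (∑-cong p λ i _ → trans (cong (_/ p) (+-swap w m (b i))) ([m+n]/d≡m/d+[m%d+n]/d (w + b i) m p))
                         (∑-+ p _ _)
    where
    +-swap : ∀ w m b → w + m + b ≡ w + b + m
    +-swap = solve-∀

  carry-cocycle : ∀ m n w → carry m w + carry n (w + m) ≡ carry (m + n) w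
  carry-cocycle m n w = +-cancelˡ-≡ (floorSum w) _ _ (begin
    floorSum w + (carry m w + carry n (w + m))   ≡⟨ +-assoc (floorSum w) _ _ ⟨
    floorSum w + carry m w + carry n (w + m)     ≡⟨ cong (_+ carry n (w + m)) (floorSum-+ w m) ⟨
    floorSum (w + m) + carry n (w + m)           ≡⟨ floorSum-+ (w + m) n ⟨
    floorSum (w + m + n)                         ≡⟨ cong floorSum (+-assoc w m n) ⟩
    floorSum (w + (m + n))                       ≡⟨ floorSum-+ w (m + n) ⟩
    floorSum w + carry (m + n) w                 ∎)
    where open ≡-Reasoning

  carry-mod : ∀ m {u v} → u % p ≡ v % p → carry m u ≡ carry m v
  carry-mod m u≡v = ∑-cong p λ i _ → cong (λ r → (r + m) / p) (%-+-congˡ (b i) u≡v)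

  carry-1 : ∀ w → carry 1 w ≡ ∑[ i < p ] 𝟙 (p ∣? w + suc (b i))
  carry-1 w = ∑-cong p λ i _ → trans ([m%d+1]/d≡𝟙[d∣1+m] (w + b i) p) (cong (λ n → 𝟙 (p ∣? n)) (sym (+-suc w (b i))))

  carry-0 : ∀ w → carry 0 w ≡ 0
  carry-0 w = ∑-zero p λ i _ → trans (cong (_/ p) (+-identityʳ _)) (m<n⇒m/n≡0 (m%n<n (w + b i) p))

  carry-1-constant : ∀ {z} → (∀ w → carry 1 w ≡ z) → ∀ m w → carry m w ≡ m * z
  carry-1-constant const zero w = carry-0 w
  carry-1-constant {z} const (suc m) w = begin
    carry (suc m) w              ≡⟨ carry-cocycle 1 m w ⟨
    carry 1 w + carry m (w + 1)  ≡⟨ cong₂ _+_ (const w) (carry-1-constant const m (w + 1)) ⟩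
    z + m * z                    ∎
    where open ≡-Reasoning

  carry-invariant⇒carry-1-constant : ∀ {m x} → (m * x) % p ≡ 1 % p →
    (∀ w → carry m (w + m) ≡ carry m w) → ∀ w → carry 1 w ≡ carry 1 0
  carry-invariant⇒carry-1-constant {m} m*x≡1 invariant = translation-invariant⇒constant (carry-mod 1) m*x≡1 carry-1-invariant
    where
    carry-m-constant : ∀ w → carry m w ≡ carry m 0
    carry-m-constant = translation-invariant⇒constant (carry-mod m) m*x≡1 invariant

    carry-1-invariant : ∀ w → carry 1 (w + m) ≡ carry 1 w
    carry-1-invariant w = +-cancelˡ-≡ (carry m w) _ _ (begin
      carry m w + carry 1 (w + m)   ≡⟨ carry-cocycle m 1 w ⟩
      carry (m + 1) w               ≡⟨ cong (λ n → carry n w) (+-comm m 1) ⟩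
      carry (1 + m) w               ≡⟨ carry-cocycle 1 m w ⟨
      carry 1 w + carry m (w + 1)   ≡⟨ cong (carry 1 w +_) (trans (carry-m-constant (w + 1)) (sym (carry-m-constant w))) ⟩
      carry 1 w + carry m w         ≡⟨ +-comm (carry 1 w) _ ⟩
      carry m w + carry 1 w         ∎)
      where open ≡-Reasoning

module Lattice (p q : ℕ) .{{_ : NonZero p}} .{{_ : NonZero q}} where

  Q P² : ℕ
  Q = q * q
  P² = p * p

  instance
    Q≢0 : NonZero Q
    Q≢0 = m*n≢0 q q
    P²≢0 : NonZero P²
    P²≢0 = m*n≢0 p p

  column : ℕ → ℕ → ℕ → ℕ
  column L N x = ∑[ y < N ] 𝟙 (Q * x + P² * y ≤? L)

  lattice : ℕ → ℕ
  lattice L = ∑[ x < suc L ] column L (suc L) x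

  ehrhart≡lattice : ∀ t → ehrhart p q t ≡ lattice (p * q * t)
  ehrhart≡lattice t = length-filter-cartesianProduct (inDilate? p q t) (λ x → x) (suc M) (suc M)
    where M = p * q * t

  column-stable : ∀ {L N} x → L < N → column L N x ≡ column L (suc L) x
  column-stable {L} x L<N = ∑-truncate _ L<N λ y L<y →
    𝟙-no (Q * x + P² * y ≤? L) λ in-range → <⇒≱ L<y (≤-trans (m≤n*m y P²) (m+n≤o⇒n≤o (Q * x) in-range))

  lattice-bounds : ∀ {L M N} → L < M → L < N → ∑[ x < M ] column L N x ≡ lattice L
  lattice-bounds {L} {M} L<M L<N = trans (∑-cong M λ x _ → column-stable x L<N) (∑-truncate _ L<M vanish)
    where
    vanish : ∀ x → suc L ≤ x → column L (suc L) x ≡ 0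
    vanish x L<x = ∑-zero (suc L) λ y _ → 𝟙-no (Q * x + P² * y ≤? L)
      λ in-range → <⇒≱ L<x (≤-trans (m≤n*m x Q) (m+n≤o⇒m≤o (Q * x) in-range))

  column-closed : ∀ {L N x R} → Q * x + R ≡ L → L < N → column L N x ≡ suc (R / P²)
  column-closed {L} {N} {x} {R} refl L<N = trans (∑-cong N λ y _ → 𝟙-cong (Q * x + P² * y ≤? L) (y ≤? R / P²) ⇒ ⇐)
                                                 (∑-𝟙-≤ (≤-<-trans (m/n≤m R P²) (≤-<-trans (m≤n+m R (Q * x)) L<N)))
    where
    ⇒ : ∀ {y} → Q * x + P² * y ≤ L → y ≤ R / P²
    ⇒ {y} le = subst (_≤ R / P²) (m*n/n≡m y P²) (/-monoˡ-≤ P² (subst (_≤ R) (*-comm P² y) (+-cancelˡ-≤ (Q * x) _ _ le)))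
    ⇐ : ∀ {y} → y ≤ R / P² → Q * x + P² * y ≤ L
    ⇐ {y} le = +-monoʳ-≤ (Q * x) (≤-trans (subst (_≤ R / P² * P²) (*-comm y P²) (*-monoˡ-≤ P² le)) (m/n*n≤m R P²))

  lattice-shift : ∀ L → lattice (L + p * Q) ≡ lattice L + ∑[ i < p ] suc ((L + Q * suc i) / P²)
  lattice-shift L = begin
    lattice L′                                                          ≡⟨ lattice-bounds L′<p+N L′<p+N ⟨
    ∑[ x < p + N ] column L′ (p + N) x                                  ≡⟨ ∑-split p N _ ⟩
    ∑[ x < p ] column L′ (p + N) x + ∑[ x < N ] column L′ (p + N) (p + x) ≡⟨ cong₂ _+_ near-axis shifted ⟩
    ∑[ i < p ] suc ((L + Q * suc i) / P²) + lattice L                  ≡⟨ +-comm _ (lattice L) ⟩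
    lattice L + ∑[ i < p ] suc ((L + Q * suc i) / P²)                  ∎
    where
    open ≡-Reasoning
    L′ = L + p * Q
    N = suc L′
    L′<p+N : L′ < p + N
    L′<p+N = m≤n+m N p

    near-axis : ∑[ x < p ] column L′ (p + N) x ≡ ∑[ i < p ] suc ((L + Q * suc i) / P²)
    near-axis = trans (∑-reverse p _) (∑-cong p λ i i<p → column-closed (split i i<p) L′<p+N)
      where
      split : ∀ i → i < p → Q * (p ∸ suc i) + (L + Q * suc i) ≡ L′
      split i i<p = trans (regroup Q (p ∸ suc i) (suc i) L) (cong (λ k → L + k * Q) (m∸n+n≡m i<p))
        where
        regroup : ∀ Q a k L → Q * a + (L + Q * k) ≡ L + (a + k) * Q
        regroup = solve-∀

    shifted : ∑[ x < N ] column L′ (p + N) (p + x) ≡ lattice L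
    shifted = trans (∑-cong N λ x _ → ∑-cong (p + N) λ y _ →
                       𝟙-cong (Q * (p + x) + P² * y ≤? L′) (Q * x + P² * y ≤? L) (unshift x y) (shift x y))
                    (lattice-bounds (≤-<-trans (m≤m+n L (p * Q)) ≤-refl) (≤-<-trans (m≤m+n L (p * Q)) (m≤n+m N p)))
      where
      regroup : ∀ x y → Q * (p + x) + P² * y ≡ p * Q + (Q * x + P² * y)
      regroup x y = distrib Q p x P² y
        where
        distrib : ∀ Q p x P y → Q * (p + x) + P * y ≡ p * Q + (Q * x + P * y)
        distrib = solve-∀
      unshift : ∀ x y → Q * (p + x) + P² * y ≤ L′ → Q * x + P² * y ≤ L
      unshift x y le = +-cancelˡ-≤ (p * Q) _ _ (subst₂ _≤_ (regroup x y) (+-comm L (p * Q)) le)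
      shift : ∀ x y → Q * x + P² * y ≤ L → Q * (p + x) + P² * y ≤ L′
      shift x y le = subst₂ _≤_ (sym (regroup x y)) (+-comm (p * Q) L) (+-monoʳ-≤ (p * Q) le)

module Floors (p q : ℕ) .{{_ : NonZero p}} where

  Q : ℕ
  Q = q * q

  hits : ℕ → ℕ
  hits w = ∑[ i < p ] 𝟙 (p ∣? w + suc (Q * suc i / p))

  ∣-+-mod : ∀ {u v} k → u % p ≡ v % p → p ∣ u + k → p ∣ v + k
  ∣-+-mod {u} {v} k u≡v p∣u+k = m%n≡0⇒n∣m (v + k) p (trans (sym (%-+-congˡ k u≡v)) (n∣m⇒m%n≡0 (u + k) p p∣u+k))

  hits-mod : ∀ {u v} → u % p ≡ v % p → hits u ≡ hits v
  hits-mod {u} {v} u≡v = ∑-cong p λ i _ → let k = suc (Q * suc i / p) in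
    𝟙-cong (p ∣? u + k) (p ∣? v + k) (∣-+-mod k u≡v) (∣-+-mod k (sym u≡v))

  ∤Q*k : Coprime p q → ∀ {k} → 0 < k → k < p → (Q * k) % p ≢ 0
  ∤Q*k p⊥q {k} 0<k k<p Qk%p≡0 = <⇒≱ k<p (∣⇒≤ {{>-nonZero 0<k}} p∣k)
    where
    p∣k : p ∣ k
    p∣k = coprime-divisor p⊥q (coprime-divisor p⊥q (subst (p ∣_) (*-assoc q q k) (m%n≡0⇒n∣m _ p Qk%p≡0)))

  -- The remainders of Q k and Q l are nonzero and sum to less than 2p, and
  -- Q p = (⌊Qk/p⌋ + ⌊Ql/p⌋) p + (sum of the remainders).
  floor-complement : Coprime p q → ∀ {k l} → k + l ≡ p → 0 < k → 0 < l → Q * k / p + Q * l / p + 1 ≡ Q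
  floor-complement p⊥q {k} {l} k+l≡p 0<k 0<l = trans (+-comm S 1) (≤-antisym S<Q (s≤s⁻¹ Q<S+2))
    where
    S = Q * k / p + Q * l / p
    r₁ = (Q * k) % p
    r₂ = (Q * l) % p
    Q*p≡ : Q * p ≡ (r₁ + r₂) + S * p
    Q*p≡ = begin
      Q * p                                          ≡⟨ cong (Q *_) k+l≡p ⟨
      Q * (k + l)                                    ≡⟨ *-distribˡ-+ Q k l ⟩
      Q * k + Q * l                                  ≡⟨ cong₂ _+_ (m≡m%n+[m/n]*n (Q * k) p) (m≡m%n+[m/n]*n (Q * l) p) ⟩
      (r₁ + Q * k / p * p) + (r₂ + Q * l / p * p)    ≡⟨ regroup r₁ r₂ (Q * k / p) (Q * l / p) p ⟩
      (r₁ + r₂) + S * p                              ∎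
      where
      open ≡-Reasoning
      regroup : ∀ r₁ r₂ x y p → (r₁ + x * p) + (r₂ + y * p) ≡ (r₁ + r₂) + (x + y) * p
      regroup = solve-∀
    k<p : k < p
    k<p = subst (k <_) k+l≡p (m<m+n k 0<l)
    S<Q : S < Q
    S<Q = *-cancelʳ-< p S Q (subst (S * p <_) (sym Q*p≡)
            (m<n+m (S * p) (<-≤-trans (n≢0⇒n>0 (∤Q*k p⊥q 0<k k<p)) (m≤m+n r₁ r₂))))
    Q<S+2 : Q < 2 + S
    Q<S+2 = *-cancelʳ-< p Q (2 + S) (subst (_< (2 + S) * p) (sym Q*p≡)
              (subst ((r₁ + r₂) + S * p <_) (regroup p S) (+-monoˡ-< (S * p) (+-mono-< (m%n<n (Q * k) p) (m%n<n (Q * l) p)))))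
      where
      regroup : ∀ p S → (p + p) + S * p ≡ (2 + S) * p
      regroup = solve-∀

  floor-when-divides : ∀ {c} → c * p ≡ Q + 1 → ∀ {k} → 0 < k → k ≤ p → suc (Q * k / p) ≡ c * k
  floor-when-divides {c} c*p≡Q+1 {k} 0<k k≤p = begin
    suc (Q * k / p)                    ≡⟨ +-comm 1 _ ⟩
    Q * k / p + 1                      ≡⟨ cong (Q * k / p +_) (n/n≡1 p) ⟨
    Q * k / p + p / p                  ≡⟨ +-distrib-/-∣ʳ (Q * k) (∣-refl {p}) ⟨
    (Q * k + p) / p                    ≡⟨ cong (_/ p) Q*k+p≡ ⟩
    (p * (c * k) + (p ∸ k)) / p        ≡⟨ [m*n+o]/m≡n+o/m p (c * k) (p ∸ k) ⟩
    c * k + (p ∸ k) / p                ≡⟨ cong (c * k +_) (m<n⇒m/n≡0 (∸-monoʳ-< 0<k k≤p)) ⟩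
    c * k + 0                          ≡⟨ +-identityʳ (c * k) ⟩
    c * k                              ∎
    where
    open ≡-Reasoning
    Q*k+p≡ : Q * k + p ≡ p * (c * k) + (p ∸ k)
    Q*k+p≡ = begin
      Q * k + p                        ≡⟨ cong (Q * k +_) (m+[n∸m]≡n k≤p) ⟨
      Q * k + (k + (p ∸ k))            ≡⟨ regroup Q k (p ∸ k) ⟩
      (Q + 1) * k + (p ∸ k)            ≡⟨ cong (λ x → x * k + (p ∸ k)) c*p≡Q+1 ⟨
      c * p * k + (p ∸ k)              ≡⟨ cong (_+ (p ∸ k)) (trans (cong (_* k) (*-comm c p)) (*-assoc p c k)) ⟩
      p * (c * k) + (p ∸ k)            ∎
      where
      regroup : ∀ Q k r → Q * k + (k + r) ≡ (Q + 1) * k + r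
      regroup = solve-∀

  -- Pairing i with a ∸ suc i matches the terms of hits 0 and hits w₀, where w₀ ≡ -(Q + 1),
  -- except the last ones, which are [p ∣ Q + 1] and 1.
  hits-constant⇒p∣Q+1 : Coprime p q → (∀ w → hits w ≡ hits 0) → p ∣ Q + 1
  hits-constant⇒p∣Q+1 p⊥q const = subst (p ∣_) (+-comm 1 Q) (𝟙-positive (p ∣? 0 + suc Q) (subst (0 <_) (sym last₀≡1) z<s))
    where
    a = pred p
    w₀ = a * suc Q
    term : ℕ → ℕ → ℕ
    term w i = 𝟙 (p ∣? w + suc (Q * suc i / p))

    split : ∀ w → hits w ≡ ∑< a (term w) + 𝟙 (p ∣? w + suc Q)
    split w = begin
      hits w                                              ≡⟨ cong (λ n → ∑< n (term w)) (suc-pred p) ⟨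
      ∑< (suc a) (term w)                                 ≡⟨ ∑-last a (term w) ⟩
      ∑< a (term w) + 𝟙 (p ∣? w + suc (Q * suc a / p))    ≡⟨ cong (λ x → ∑< a (term w) + 𝟙 (p ∣? w + suc x)) Q*p/p≡Q ⟩
      ∑< a (term w) + 𝟙 (p ∣? w + suc Q)                  ∎
      where
      open ≡-Reasoning
      Q*p/p≡Q : Q * suc a / p ≡ Q
      Q*p/p≡Q = trans (cong (λ n → Q * n / p) (suc-pred p)) (m*n/n≡m Q p)

    w₀+1+Q≡p*[1+Q] : w₀ + suc Q ≡ p * suc Q
    w₀+1+Q≡p*[1+Q] = trans (+-comm w₀ (suc Q)) (cong (_* suc Q) (suc-pred p))

    paired : ∑< a (term 0) ≡ ∑< a (term w₀)
    paired = trans (∑-cong a pair) (sym (∑-reverse a (term w₀)))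
      where
      pair : ∀ i → i < a → term 0 i ≡ term w₀ (a ∸ suc i)
      pair i i<a = 𝟙-cong (p ∣? x) (p ∣? y)
        (∣m+n∣m⇒∣n p∣x+y) (∣m+n∣m⇒∣n (subst (p ∣_) (+-comm x y) p∣x+y))
        where
        j = a ∸ suc i
        x = suc (Q * suc i / p)
        y = w₀ + suc (Q * suc j / p)
        complement : Q * suc i / p + Q * suc j / p + 1 ≡ Q
        complement = floor-complement p⊥q (trans (+-suc (suc i) j) (trans (cong suc (m+[n∸m]≡n i<a)) (suc-pred p))) z<s z<s
        p∣x+y : p ∣ x + y
        p∣x+y = subst (p ∣_) (sym x+y≡p*[1+Q]) (m∣m*n (suc Q))
          where
          open ≡-Reasoning
          regroup : ∀ u v w → suc u + (w + suc v) ≡ w + suc (u + v + 1)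
          regroup = solve-∀
          x+y≡p*[1+Q] : x + y ≡ p * suc Q
          x+y≡p*[1+Q] = begin
            x + y                                            ≡⟨ regroup (Q * suc i / p) (Q * suc j / p) w₀ ⟩
            w₀ + suc (Q * suc i / p + Q * suc j / p + 1)     ≡⟨ cong (λ z → w₀ + suc z) complement ⟩
            w₀ + suc Q                                       ≡⟨ w₀+1+Q≡p*[1+Q] ⟩
            p * suc Q                                        ∎

    last₀≡1 : 𝟙 (p ∣? 0 + suc Q) ≡ 1
    last₀≡1 = +-cancelˡ-≡ (∑< a (term 0)) _ _ (begin
      ∑< a (term 0) + 𝟙 (p ∣? 0 + suc Q)       ≡⟨ split 0 ⟨
      hits 0                                   ≡⟨ const w₀ ⟨
      hits w₀                                  ≡⟨ split w₀ ⟩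
      ∑< a (term w₀) + 𝟙 (p ∣? w₀ + suc Q)     ≡⟨ cong₂ _+_ (sym paired) (𝟙-yes (p ∣? w₀ + suc Q) p∣w₀+1+Q) ⟩
      ∑< a (term 0) + 1                        ∎)
      where
      open ≡-Reasoning
      p∣w₀+1+Q : p ∣ w₀ + suc Q
      p∣w₀+1+Q = subst (p ∣_) (sym w₀+1+Q≡p*[1+Q]) (m∣m*n (suc Q))

  module _ {c} (c*p≡Q+1 : c * p ≡ Q + 1) where

    hits≡ : ∀ w → hits w ≡ ∑[ i < p ] 𝟙 (p ∣? w + c * suc i)
    hits≡ w = ∑-cong p λ i i<p → cong (λ x → 𝟙 (p ∣? w + x)) (floor-when-divides {c} c*p≡Q+1 z<s i<p)

    0<hits₀ : 0 < hits 0
    0<hits₀ = <-≤-trans (subst (0 <_) (sym (𝟙-yes (p ∣? 0 + c * suc a) p∣c*p)) z<s)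
                        (subst (𝟙 (p ∣? 0 + c * suc a) ≤_) (sym (hits≡ 0)) (term≤∑ p _ a<p))
      where
      a = pred p
      a<p : a < p
      a<p = subst (a <_) (suc-pred p) ≤-refl
      p∣c*p : p ∣ 0 + c * suc a
      p∣c*p = subst (λ n → p ∣ c * n) (sym (suc-pred p)) (n∣m*n c)

    hits-constant⇒coprime : (∀ w → hits w ≡ hits 0) → Coprime c p
    hits-constant⇒coprime const (d∣c , d∣p) =
      let i , _ , positive = ∑-positive p _ (subst (0 <_) (trans (sym (const 1)) (hits≡ 1)) 0<hits₀)
          p∣1+c*[1+i] = 𝟙-positive (p ∣? 1 + c * suc i) positive
      in ∣1⇒≡1 (∣m+n∣m⇒∣n (∣-trans d∣p (subst (p ∣_) (+-comm 1 (c * suc i)) p∣1+c*[1+i]))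
                           (∣m⇒∣m*n (suc i) d∣c))

    coprime⇒hits-constant : Coprime c p → ∀ w → hits w ≡ hits 0
    coprime⇒hits-constant c⊥p = translation-invariant⇒constant hits-mod (proj₂ (coprime⇒invertible c⊥p)) shift
      where
      shift : ∀ w → hits (w + c) ≡ hits w
      shift w = begin
        hits (w + c)                                   ≡⟨ hits≡ (w + c) ⟩
        ∑[ i < p ] 𝟙 (p ∣? w + c + c * suc i)          ≡⟨ ∑-cong p (λ i _ → cong (λ n → 𝟙 (p ∣? n)) (regroup w c i)) ⟩
        ∑[ i < p ] term (suc i)                        ≡⟨ ∑-rotate p term wrap ⟩
        ∑< p term                                      ≡⟨ hits≡ w ⟨
        hits w                                         ∎
        where
        open ≡-Reasoning
        term : ℕ → ℕ
        term i = 𝟙 (p ∣? w + c * suc i)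
        regroup : ∀ w c i → w + c + c * suc i ≡ w + c * suc (suc i)
        regroup = solve-∀
        wrap : term p ≡ term 0
        wrap = 𝟙-cong (p ∣? w + c * suc p) (p ∣? w + c * 1)
                 (λ p∣ → ∣m+n∣m⇒∣n (subst (p ∣_) (regroup′ w c p) p∣) (n∣m*n c))
                 (λ p∣ → subst (p ∣_) (sym (regroup′ w c p)) (∣m∣n⇒∣m+n (n∣m*n c) p∣))
          where
          regroup′ : ∀ w c p → w + c * suc p ≡ c * p + (w + c * 1)
          regroup′ = solve-∀

  hits-constant⇔divisibility : Coprime p q → (∀ w → hits w ≡ hits 0) ⇔ (p ∣ Q + 1 × gcd ((Q + 1) / p) p ≡ 1)
  hits-constant⇔divisibility p⊥q = mk⇔
    (λ const → let p∣Q+1 = hits-constant⇒p∣Q+1 p⊥q const in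
               p∣Q+1 , coprime⇒gcd≡1 (hits-constant⇒coprime {c} (m/n*n≡m p∣Q+1) const))
    (λ (p∣Q+1 , gcd≡1) → coprime⇒hits-constant {c} (m/n*n≡m p∣Q+1) (gcd≡1⇒coprime gcd≡1))
    where c = (Q + 1) / p

module Criterion (p q : ℕ) .{{_ : NonZero p}} .{{_ : NonZero q}} where

  open Lattice p q using (Q; P²; P²≢0; lattice; ehrhart≡lattice; lattice-shift)
  open Carries p (λ i → Q * suc i / p)
  open Floors p q using (hits)

  D : ℕ → ℕ
  D t = p + floorSum (q * t)

  ehrhart-step : ∀ t → ehrhart p q (t + q) ≡ ehrhart p q t + D t
  ehrhart-step t = begin
    ehrhart p q (t + q)                                   ≡⟨ ehrhart≡lattice (t + q) ⟩
    lattice (p * q * (t + q))                             ≡⟨ cong lattice (distrib p q t) ⟩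
    lattice (p * q * t + p * Q)                           ≡⟨ lattice-shift (p * q * t) ⟩
    lattice (p * q * t) + ∑[ i < p ] suc ((p * q * t + Q * suc i) / P²) ≡⟨ cong₂ _+_ (ehrhart≡lattice t) near-axis ⟨
    ehrhart p q t + D t                                   ∎
    where
    open ≡-Reasoning
    distrib : ∀ p q t → p * q * (t + q) ≡ p * q * t + p * (q * q)
    distrib = solve-∀
    near-axis : D t ≡ ∑[ i < p ] suc ((p * q * t + Q * suc i) / P²)
    near-axis = begin
      p + floorSum (q * t)                                ≡⟨ cong (_+ floorSum (q * t)) (trans (∑-const p 1) (*-identityʳ p)) ⟨
      ∑[ _ < p ] 1 + floorSum (q * t)                     ≡⟨ ∑-+ p (λ _ → 1) _ ⟨
      ∑[ i < p ] suc ((q * t + Q * suc i / p) / p)        ≡⟨ ∑-cong p (λ i _ → cong suc (sym (divide-twice i))) ⟩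
      ∑[ i < p ] suc ((p * q * t + Q * suc i) / P²)       ∎
      where
      divide-twice : ∀ i → (p * q * t + Q * suc i) / P² ≡ (q * t + Q * suc i / p) / p
      divide-twice i = begin
        (p * q * t + Q * suc i) / P²           ≡⟨ m/n/o≡m/[n*o] _ p p ⟨
        (p * q * t + Q * suc i) / p / p        ≡⟨ cong (λ x → (x + Q * suc i) / p / p) (*-assoc p q t) ⟩
        (p * (q * t) + Q * suc i) / p / p      ≡⟨ cong (_/ p) ([m*n+o]/m≡n+o/m p (q * t) (Q * suc i)) ⟩
        (q * t + Q * suc i / p) / p            ∎

  D-step : ∀ t → D (t + q) ≡ D t + carry Q (q * t)
  D-step t = begin
    p + floorSum (q * (t + q))                   ≡⟨ cong (λ x → p + floorSum x) (*-distribˡ-+ q t q) ⟩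
    p + floorSum (q * t + Q)                     ≡⟨ cong (p +_) (floorSum-+ (q * t) Q) ⟩
    p + (floorSum (q * t) + carry Q (q * t))     ≡⟨ +-assoc p _ _ ⟨
    D t + carry Q (q * t)                        ∎
    where open ≡-Reasoning

  quasiPeriod⇒carry-invariant : IsQuasiPeriod (ehrhart p q) q → ∀ t → 1 ≤ t → carry Q (q * t + Q) ≡ carry Q (q * t)
  quasiPeriod⇒carry-invariant qp t 1≤t =
    trans (cong (carry Q) (sym (*-distribˡ-+ q t q)))
          (third-difference⇒periodic-increment {ehrhart p q} {D} {λ s → carry Q (q * s)} ehrhart-step D-step t
             (quasiPeriod⇒third-difference {ehrhart p q} qp t 1≤t))

  carry-invariant⇒hits-constant : Coprime p q → (∀ t → 1 ≤ t → carry Q (q * t + Q) ≡ carry Q (q * t)) →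
    ∀ w → hits w ≡ hits 0
  carry-invariant⇒hits-constant p⊥q invariant w = begin
    hits w       ≡⟨ carry-1 w ⟨
    carry 1 w    ≡⟨ carry-invariant⇒carry-1-constant (proj₂ Q-invertible) invariant′ w ⟩
    carry 1 0    ≡⟨ carry-1 0 ⟩
    hits 0       ∎
    where
    open ≡-Reasoning
    Q-invertible : ∃[ x ] (Q * x) % p ≡ 1 % p
    Q-invertible = coprime⇒invertible (Coprime.sym (coprime-*ʳ p⊥q p⊥q))
    q-invertible : ∃[ x ] (q * x) % p ≡ 1 % p
    q-invertible = coprime⇒invertible (Coprime.sym p⊥q)

    -- Every residue class mod p contains some q t with t ≥ 1.
    invariant′ : ∀ w → carry Q (w + Q) ≡ carry Q w
    invariant′ w = trans (carry-mod Q (%-+-congˡ Q (sym qt≡w))) (trans (invariant t 1≤t) (carry-mod Q qt≡w))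
      where
      x = proj₁ q-invertible
      t = p + x * w
      1≤t : 1 ≤ t
      1≤t = ≤-trans (>-nonZero⁻¹ p) (m≤m+n p (x * w))
      qt≡w : (q * t) % p ≡ w % p
      qt≡w = trans (cong (_% p) (regroup q p x w))
                   (trans ([m+kn]%n≡m%n (q * x * w) q p) (inverse-cancel {c = q} w (proj₂ q-invertible)))
        where
        regroup : ∀ q p x w → q * (p + x * w) ≡ q * x * w + q * p
        regroup = solve-∀

  hits-constant⇒quasiPeriod : (∀ w → hits w ≡ hits 0) → IsQuasiPeriod (ehrhart p q) q
  hits-constant⇒quasiPeriod const = constant-second-difference⇒quasiPeriod {ehrhart p q} {D} ehrhart-step λ t →
    trans (D-step t) (cong (D t +_) (carry-1-constant (λ w → trans (carry-1 w) (const w)) Q (q * t)))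

theorem3p1 : (p q : ℕ) .{{_ : NonZero p}} .{{_ : NonZero q}} → Coprime p q →
    (IsQuasiPeriod (ehrhart p q) q ⇔
      (p ∣ q * q + 1 × gcd ((q * q + 1) / p) p ≡ 1))
theorem3p1 p q p⊥q = mk⇔
  (λ qp → to (carry-invariant⇒hits-constant p⊥q (quasiPeriod⇒carry-invariant qp)))
  (λ divisibility → hits-constant⇒quasiPeriod (from divisibility))
  where
  open Criterion p q
  open Equivalence (Floors.hits-constant⇔divisibility p q p⊥q)
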